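{- Let $(A,\rightarrow,\rightsquigarrow,0,1)$ be a bounded pseudo-BE algebra and let $s$ be a Bosbach state on $A$ with $s(0)=0$. Then $\mathrm{Ker}(s)=\{x\in A\mid s(x)=1\}$ is an involutive deductive system of $A$.
   Context: A pseudo-BE algebra is an algebra $(A,\rightarrow,\rightsquigarrow,1)$ of type $(2,2,0)$ such that for all $x,y,z\in A$: $x\rightarrow x=x\rightsquigarrow x=1$; $x\rightarrow 1=x\rightsquigarrow 1=1$; $1\rightarrow x=1\rightsquigarrow x=x$; $x\rightarrow(y\rightsquigarrow z)=y\rightsquigarrow(x\rightarrow z)$; $x\rightarrow y=1$ iff $x\rightsquigarrow y=1$. Write $x\le y$ iff $x\rightarrow y=1$. It is bounded if it has an element $0$ with $0\le x$ for all $x$; then $x^-=x\rightarrow 0$, $x^\sim=x\rightsquigarrow 0$, and $x^{ -\sim}=(x^-)^\sim$, $x^{\sim- }=(x^\sim)^-$. A Bosbach state is a map $s:A\to[0,1]$ with $s(1)=1$, $s(x)+s(x\rightarrow y)=s(y)+s(y\rightarrow x)$ and $s(x)+s(x\rightsquigarrow y)=s(y)+s(y\rightsquigarrow x)$ for all $x,y$. A deductive system is $D\subseteq A$ with $1\in D$ such that $x\in D$, $x\rightarrow y\in D$ imply $y\in D$; it is involutive if $x^{ -\sim}\rightarrow x\in D$ and $x^{\sim- }\rightsquigarrow x\in D$ for all $x\in A$. -}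

module Defs where

open import Level using (Level; suc; _⊔_)
open import Relation.Binary.PropositionalEquality using (_≡_)
open import Data.Product using (Σ; _×_; ∃)
open import Data.Sum using (_⊎_)
open import Relation.Nullary using (¬_)

record Reals (ℓ : Level) : Set (suc ℓ) where
  infixl 6 _+_
  infixl 7 _*_
  infix  4 _≤_
  field
    ℝ     : Set ℓ
    _+_   : ℝ → ℝ → ℝ
    _*_   : ℝ → ℝ → ℝ
    -_    : ℝ → ℝ
    0r 1r : ℝ
    _≤_   : ℝ → ℝ → Set ℓ
    +-assoc   : ∀ x y z → (x + y) + z ≡ x + (y + z)
    +-comm    : ∀ x y → x + y ≡ y + x
    +-identityˡ : ∀ x → 0r + x ≡ x
    -‿inverseˡ : ∀ x → (- x) + x ≡ 0r
    *-assoc   : ∀ x y z → (x * y) * z ≡ x * (y * z)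
    *-comm    : ∀ x y → x * y ≡ y * x
    *-identityˡ : ∀ x → 1r * x ≡ x
    distribˡ  : ∀ x y z → x * (y + z) ≡ (x * y) + (x * z)
    0≢1       : ¬ (0r ≡ 1r)
    *-inverse : ∀ x → ¬ (x ≡ 0r) → Σ ℝ (λ y → y * x ≡ 1r)
    ≤-refl    : ∀ x → x ≤ x
    ≤-trans   : ∀ {x y z} → x ≤ y → y ≤ z → x ≤ z
    ≤-antisym : ∀ {x y} → x ≤ y → y ≤ x → x ≡ y
    ≤-total   : ∀ x y → x ≤ y ⊎ y ≤ x
    +-mono-≤  : ∀ {x y} z → x ≤ y → x + z ≤ y + z
    *-nonneg  : ∀ {x y} → 0r ≤ x → 0r ≤ y → 0r ≤ x * y
    complete  : (P : ℝ → Set ℓ) → ∃ P → (Σ ℝ λ b → ∀ x → P x → x ≤ b) →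
                Σ ℝ λ u → (∀ x → P x → x ≤ u) ×
                          (∀ b → (∀ x → P x → x ≤ b) → u ≤ b)

record PseudoBE (a : Level) : Set (suc a) where
  infixr 5 _⇒_ _⇝_
  field
    A   : Set a
    _⇒_ : A → A → A
    _⇝_ : A → A → A
    𝟙   : A
    ⇒-refl  : ∀ x → x ⇒ x ≡ 𝟙
    ⇝-refl  : ∀ x → x ⇝ x ≡ 𝟙
    ⇒-top   : ∀ x → x ⇒ 𝟙 ≡ 𝟙
    ⇝-top   : ∀ x → x ⇝ 𝟙 ≡ 𝟙
    ⇒-left  : ∀ x → 𝟙 ⇒ x ≡ x
    ⇝-left  : ∀ x → 𝟙 ⇝ x ≡ x
    exchange : ∀ x y z → x ⇒ (y ⇝ z) ≡ y ⇝ (x ⇒ z)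
    ⇒⇝-one  : ∀ x y → (x ⇒ y ≡ 𝟙 → x ⇝ y ≡ 𝟙) × (x ⇝ y ≡ 𝟙 → x ⇒ y ≡ 𝟙)

  infix 4 _≼_
  _≼_ : A → A → Set a
  x ≼ y = x ⇒ y ≡ 𝟙

record BoundedPseudoBE (a : Level) : Set (suc a) where
  field
    pbe : PseudoBE a
  open PseudoBE pbe public
  field
    𝟘      : A
    𝟘-least : ∀ x → 𝟘 ≼ x

  _⁻ : A → A
  x ⁻ = x ⇒ 𝟘

  _∼ : A → A
  x ∼ = x ⇝ 𝟘

module _ {a} (B : PseudoBE a) where
  open PseudoBE B

  IsDeductiveSystem : ∀ {p} → (A → Set p) → Set (a ⊔ p)
  IsDeductiveSystem D = D 𝟙 × (∀ x y → D x → D (x ⇒ y) → D y)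

module _ {a} (B : BoundedPseudoBE a) where
  open BoundedPseudoBE B

  IsInvolutiveDS : ∀ {p} → (A → Set p) → Set (a ⊔ p)
  IsInvolutiveDS D = IsDeductiveSystem pbe D ×
    (∀ x → D (((x ⁻) ∼) ⇒ x)) × (∀ x → D (((x ∼) ⁻) ⇝ x))

module _ {a ℓ} (B : PseudoBE a) (R : Reals ℓ) where
  open PseudoBE B
  open Reals R

  IsBosbachState : (A → ℝ) → Set (a ⊔ ℓ)
  IsBosbachState s =
    (∀ x → 0r ≤ s x × s x ≤ 1r) ×
    s 𝟙 ≡ 1r ×
    (∀ x y → s x + s (x ⇒ y) ≡ s y + s (y ⇒ x)) ×
    (∀ x y → s x + s (x ⇝ y) ≡ s y + s (y ⇝ x))

  Ker : (A → ℝ) → A → Set ℓ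
  Ker s x = s x ≡ 1r

-- Both defining identities of a Bosbach state have the same shape
--   s x + s (x ↦ y) ≡ s y + s (y ↦ x),
-- once for ↦ = ⇒ and once for ↦ = ⇝.  So the argument is developed for an
-- arbitrary operation ↦ obeying this "Bosbach law" and then instantiated twice:
--  * if x ↦ y ≡ 1 then s y + s (y ↦ x) ≡ s x + 1      (complement law);
--  * hence s x + s (x ↦ 0) ≡ 1 when s 0 ≡ 0          (negation law);
--  * and s (y ↦ x) ≡ 1 when x ↦ y ≡ 1 and s x ≡ s y   (equal values give 1);
--  * and Ker(s) is closed under modus ponens for ↦, since s ≤ 1.
-- In a bounded pseudo-BE algebra x ≤ x⁻∼ and x ≤ x∼⁻; the negation laws for
-- ⇒ and ⇝ make s (x⁻∼) ≡ s x ≡ s (x∼⁻), so x⁻∼ ⇒ x and x∼⁻ ⇝ x lie in Ker(s).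
module Submission where

open import Defs
open import Relation.Binary.PropositionalEquality
  using (_≡_; sym; trans; cong; subst; module ≡-Reasoning)
open import Data.Product using (_,_; proj₁; proj₂)

module FieldFacts {ℓ} (R : Reals ℓ) where
  open Reals R
  open ≡-Reasoning

  -‿cancel : ∀ p x → (- p) + (p + x) ≡ x
  -‿cancel p x = begin
    (- p) + (p + x)  ≡⟨ sym (+-assoc (- p) p x) ⟩
    ((- p) + p) + x  ≡⟨ cong (_+ x) (-‿inverseˡ p) ⟩
    0r + x           ≡⟨ +-identityˡ x ⟩
    x                ∎

  +-cancelˡ : ∀ p {q r} → p + q ≡ p + r → q ≡ r
  +-cancelˡ p {q} {r} e = begin
    q                ≡⟨ sym (-‿cancel p q) ⟩
    (- p) + (p + q)  ≡⟨ cong ((- p) +_) e ⟩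
    (- p) + (p + r)  ≡⟨ -‿cancel p r ⟩
    r                ∎

  complement-unique : ∀ {a b c} → a + b ≡ 1r → b + c ≡ 1r → c ≡ a
  complement-unique {a} {b} {c} ab bc =
    +-cancelˡ b (trans bc (sym (trans (+-comm b a) ab)))

  +-monoʳ-≤ : ∀ z {x y} → x ≤ y → z + x ≤ z + y
  +-monoʳ-≤ z {x} {y} x≤y =
    subst (_≤ z + y) (+-comm x z) (subst (x + z ≤_) (+-comm y z) (+-mono-≤ z x≤y))

  +-cancelʳ-≤ : ∀ {p q} r → p + r ≤ q + r → p ≤ q
  +-cancelʳ-≤ {p} {q} r h =
    subst (_≤ q) (undo p) (subst (p + r + - r ≤_) (undo q) (+-mono-≤ (- r) h))
    where
    undo : ∀ x → x + r + - r ≡ x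
    undo x = begin
      x + r + - r    ≡⟨ +-assoc x r (- r) ⟩
      x + (r + - r)  ≡⟨ cong (x +_) (+-comm r (- r)) ⟩
      x + (- r + r)  ≡⟨ cong (x +_) (-‿inverseˡ r) ⟩
      x + 0r         ≡⟨ +-comm x 0r ⟩
      0r + x         ≡⟨ +-identityˡ x ⟩
      x              ∎

module BosbachLaw {a ℓ} (R : Reals ℓ) {A : Set a} (s : A → Reals.ℝ R) (𝟙 : A)
  (_↦_ : A → A → A)
  (law : ∀ x y → Reals._+_ R (s x) (s (x ↦ y)) ≡ Reals._+_ R (s y) (s (y ↦ x)))
  (s𝟙 : s 𝟙 ≡ Reals.1r R) where
  open Reals R
  open FieldFacts R
  open ≡-Reasoning

  complement-law : ∀ {x y} → x ↦ y ≡ 𝟙 → s y + s (y ↦ x) ≡ s x + 1r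
  complement-law {x} {y} x↦y = begin
    s y + s (y ↦ x)  ≡⟨ sym (law x y) ⟩
    s x + s (x ↦ y)  ≡⟨ cong (λ u → s x + s u) x↦y ⟩
    s x + s 𝟙        ≡⟨ cong (s x +_) s𝟙 ⟩
    s x + 1r         ∎

  negation-law : ∀ {𝟘} → s 𝟘 ≡ 0r → (∀ x → 𝟘 ↦ x ≡ 𝟙) → ∀ x → s x + s (x ↦ 𝟘) ≡ 1r
  negation-law {𝟘} s𝟘 least x = begin
    s x + s (x ↦ 𝟘)  ≡⟨ complement-law (least x) ⟩
    s 𝟘 + 1r         ≡⟨ cong (_+ 1r) s𝟘 ⟩
    0r + 1r          ≡⟨ +-identityˡ 1r ⟩
    1r               ∎

  equal-values-in-kernel : ∀ {x y} → x ↦ y ≡ 𝟙 → s x ≡ s y → s (y ↦ x) ≡ 1r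
  equal-values-in-kernel {x} {y} x↦y sx≡sy =
    +-cancelˡ (s y) (trans (complement-law x↦y) (cong (_+ 1r) sx≡sy))

  kernel-modus-ponens : (∀ x → s x ≤ 1r) →
                        ∀ x y → s x ≡ 1r → s (x ↦ y) ≡ 1r → s y ≡ 1r
  kernel-modus-ponens s≤1 x y sx sx↦y =
    ≤-antisym (s≤1 y) (+-cancelʳ-≤ 1r two≤)
    where
    two≡ : s y + s (y ↦ x) ≡ 1r + 1r
    two≡ = begin
      s y + s (y ↦ x)  ≡⟨ sym (law x y) ⟩
      s x + s (x ↦ y)  ≡⟨ cong (_+ s (x ↦ y)) sx ⟩
      1r + s (x ↦ y)   ≡⟨ cong (1r +_) sx↦y ⟩
      1r + 1r          ∎

    two≤ : 1r + 1r ≤ s y + 1r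
    two≤ = subst (_≤ s y + 1r) two≡ (+-monoʳ-≤ (s y) (s≤1 (y ↦ x)))

module DoubleNegation {a} (B : BoundedPseudoBE a) where
  open BoundedPseudoBE B

  below-⁻∼ : ∀ x → x ⇒ ((x ⁻) ∼) ≡ 𝟙
  below-⁻∼ x = trans (exchange x (x ⁻) 𝟘) (⇝-refl (x ⁻))

  below-∼⁻ : ∀ x → x ⇝ ((x ∼) ⁻) ≡ 𝟙
  below-∼⁻ x = trans (sym (exchange (x ∼) x 𝟘)) (⇒-refl (x ∼))

  𝟘-least-⇝ : ∀ x → 𝟘 ⇝ x ≡ 𝟙
  𝟘-least-⇝ x = proj₁ (⇒⇝-one 𝟘 x) (𝟘-least x)

proposition5p19 : ∀ {a ℓ} (R : Reals ℓ) (B : BoundedPseudoBE a) (s : BoundedPseudoBE.A B → Reals.ℝ R) →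
    IsBosbachState (BoundedPseudoBE.pbe B) R s →
    s (BoundedPseudoBE.𝟘 B) ≡ Reals.0r R →
    IsInvolutiveDS B (Ker (BoundedPseudoBE.pbe B) R s)
proposition5p19 R B s (bounds , s𝟙 , law⇒ , law⇝) s𝟘 =
  (s𝟙 , Ker⇒.kernel-modus-ponens (λ x → proj₂ (bounds x))) ,
  (λ x → Ker⇒.equal-values-in-kernel (below-⁻∼ x) (sym (s⁻∼ x))) ,
  (λ x → Ker⇝.equal-values-in-kernel (below-∼⁻ x) (sym (s∼⁻ x)))
  where
  open BoundedPseudoBE B
  open DoubleNegation B
  open FieldFacts R using (complement-unique)
  module Ker⇒ = BosbachLaw R s 𝟙 _⇒_ law⇒ s𝟙
  module Ker⇝ = BosbachLaw R s 𝟙 _⇝_ law⇝ s𝟙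

  -- Double negation preserves the value of s: both sides complement s x⁻ (s x∼).
  s⁻∼ : ∀ x → s ((x ⁻) ∼) ≡ s x
  s⁻∼ x = complement-unique (Ker⇒.negation-law s𝟘 𝟘-least x) (Ker⇝.negation-law s𝟘 𝟘-least-⇝ (x ⁻))

  s∼⁻ : ∀ x → s ((x ∼) ⁻) ≡ s x
  s∼⁻ x = complement-unique (Ker⇝.negation-law s𝟘 𝟘-least-⇝ x) (Ker⇒.negation-law s𝟘 𝟘-least (x ∼))
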